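{- There exist a state $s_0$ of a PMTS and a state $t_0$ of a deterministic PMTS such that $s_0\le_t t_0$ but $s_0\not\le_m t_0$.
   Context: Boolean formulae over atoms $X$: $\varphi::=\mathbf{tt}\mid x\mid\neg\varphi\mid\varphi\wedge\varphi\mid\varphi\vee\varphi$, standard satisfaction by valuations $\nu\subseteq X$; $\mathbf{ff}=\neg\mathbf{tt}$. A PMTS over $\Sigma$ is $(S,T,P,\Phi)$ with states $S$, transitions $T\subseteq S\times\Sigma\times S$, finite parameter set $P$, obligation $\Phi:S\to\mathcal B((\Sigma\times S)\cup P)$ with $(a,t)$ occurring in $\Phi(s)$ only if $(s,a,t)\in T$. It is deterministic if $(s,a,t),(s,a,t')\in T$ imply $t=t'$. A BMTS is a PMTS with $P=\emptyset$; an implementation is a BMTS with $\Phi(s)=\bigwedge_{(s,a,t)\in T}(a,t)$ for all $s$. $T(s)=\{(a,t)\mid (s,a,t)\in T\}$, $\mathrm{Tran}(s)=\{E\subseteq T(s)\mid E\models\Phi(s)\}$ for BMTS. For $\nu\subseteq P$, $\mathcal M^\nu$ is the BMTS obtained by replacing $p\in\nu$ by $\mathbf{tt}$ and $p\notin\nu$ by $\mathbf{ff}$ in all obligations; $s^\nu$ is $s$ in $\mathcal M^\nu$. Modal refinement for BMTS: $s\le_m t$ iff $(s,t)$ is in a relation $R$ such that for all $(s,t)\in R$ and $M\in\mathrm{Tran}(s)$ there is $N\in\mathrm{Tran}(t)$ with every $(a,s')\in M$ matched by some $(a,t')\in N$ with $(s',t')\in R$ and every $(a,t')\in N$ matched by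 some $(a,s')\in M$ with $(s',t')\in R$. For PMTS: $s\le_m t$ iff for each valuation $\mu$ of the parameters of $s$'s system there is a valuation $\nu$ of those of $t$'s system with $s^\mu\le_m t^\nu$. $[\![s]\!]$ is the set of implementation states $i$ with $i\le_m s$; $s\le_t t$ iff $[\![s]\!]\subseteq[\![t]\!]$. -}

module Defs where

open import Data.Nat using (ℕ)
open import Data.Fin using (Fin)
open import Data.Bool using (Bool; true; false)
open import Data.Unit using (⊤)
open import Data.Empty using (⊥)
open import Data.Product using (Σ; Σ-syntax; ∃; _×_; _,_)
open import Data.Sum using (_⊎_; inj₁; inj₂; [_,_])
open import Data.List using (List; []; _∷_; map)
open import Data.List.Membership.Propositional using (_∈_)
open import Relation.Nullary using (¬_)
open import Relation.Binary.PropositionalEquality using (_≡_)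

data Formula (X : Set) : Set where
  tt   : Formula X
  atom : X → Formula X
  ¬'_  : Formula X → Formula X
  _∧'_ : Formula X → Formula X → Formula X
  _∨'_ : Formula X → Formula X → Formula X

ff : ∀ {X} → Formula X
ff = ¬' tt

_⊨_ : ∀ {X : Set} → (X → Set) → Formula X → Set
ν ⊨ tt       = ⊤
ν ⊨ atom x   = ν x
ν ⊨ (¬' φ)   = ¬ (ν ⊨ φ)
ν ⊨ (φ ∧' ψ) = (ν ⊨ φ) × (ν ⊨ ψ)
ν ⊨ (φ ∨' ψ) = (ν ⊨ φ) ⊎ (ν ⊨ ψ)

Occurs : ∀ {X : Set} → X → Formula X → Set
Occurs x tt       = ⊥
Occurs x (atom y) = x ≡ y
Occurs x (¬' φ)   = Occurs x φ
Occurs x (φ ∧' ψ) = Occurs x φ ⊎ Occurs x ψ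
Occurs x (φ ∨' ψ) = Occurs x φ ⊎ Occurs x ψ

-- PMTS over alphabet A with parameter set P = Fin np.
-- Transitions are given per state as a finite list T s = T(s).

record PMTS (A : Set) (np : ℕ) : Set₁ where
  field
    S : Set
    T : S → List (A × S)
    Φ : S → Formula ((A × S) ⊎ Fin np)
open PMTS public

WellFormed : ∀ {A np} → PMTS A np → Set
WellFormed M = ∀ s a t → Occurs (inj₁ (a , t)) (Φ M s) → (a , t) ∈ T M s

Deterministic : ∀ {A np} → PMTS A np → Set
Deterministic M = ∀ s a t t' → (a , t) ∈ T M s → (a , t') ∈ T M s → t ≡ t'

BMTS : Set → Set₁
BMTS A = PMTS A 0

Tran : ∀ {A} (M : BMTS A) → S M → ((A × S M) → Set) → Set
Tran M s E = (∀ x → E x → x ∈ T M s) × ([ E , (λ _ → ⊥) ] ⊨ Φ M s)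

IsModalRefinement : ∀ {A} (M N : BMTS A) → (S M → S N → Set) → Set₁
IsModalRefinement {A} M N R =
  ∀ s t → R s t → ∀ (E : A × S M → Set) → Tran M s E →
    Σ[ F ∈ (A × S N → Set) ] Tran N t F
      × (∀ a s' → E (a , s') → Σ[ t' ∈ S N ] F (a , t') × R s' t')
      × (∀ a t' → F (a , t') → Σ[ s' ∈ S M ] E (a , s') × R s' t')

_⊢_≤B_⊢_ : ∀ {A} (M : BMTS A) → S M → (N : BMTS A) → S N → Set₁
M ⊢ s ≤B N ⊢ t = Σ[ R ∈ (S M → S N → Set) ] IsModalRefinement M N R × R s t

instF : ∀ {X : Set} {np} → (Fin np → Bool) → Formula (X ⊎ Fin np) → Formula (X ⊎ Fin 0)
instF ν tt              = tt
instF ν (atom (inj₁ x)) = atom (inj₁ x)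
instF ν (atom (inj₂ p)) with ν p
... | true  = tt
... | false = ff
instF ν (¬' φ)          = ¬' instF ν φ
instF ν (φ ∧' ψ)        = instF ν φ ∧' instF ν ψ
instF ν (φ ∨' ψ)        = instF ν φ ∨' instF ν ψ

inst : ∀ {A np} → (M : PMTS A np) → (Fin np → Bool) → BMTS A
inst M ν = record { S = S M ; T = T M ; Φ = λ s → instF ν (Φ M s) }

_⊢_≤m_⊢_ : ∀ {A n₁ n₂} (M : PMTS A n₁) → S M → (N : PMTS A n₂) → S N → Set₁
M ⊢ s ≤m N ⊢ t = ∀ (μ : Fin _ → Bool) → Σ[ ν ∈ (Fin _ → Bool) ] (inst M μ ⊢ s ≤B inst N ν ⊢ t)

record LTS (A : Set) : Set₁ where
  field
    St : Set
    Tr : St → List (A × St)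
open LTS public

bigAnd : ∀ {X : Set} → List X → Formula X
bigAnd []       = tt
bigAnd (x ∷ xs) = atom x ∧' bigAnd xs

Impl : ∀ {A} → LTS A → BMTS A
Impl L = record { S = St L ; T = Tr L ; Φ = λ s → bigAnd (map inj₁ (Tr L s)) }

_⊢_≤t_⊢_ : ∀ {A n₁ n₂} (M : PMTS A n₁) → S M → (N : PMTS A n₂) → S N → Set₁
_⊢_≤t_⊢_ {A} M s N t =
  ∀ (L : LTS A) (i : St L) → Impl L ⊢ i ≤m M ⊢ s → Impl L ⊢ i ≤m N ⊢ t

{-# OPTIONS --safe #-}
module Submission where

-- The specification exclusiveChoice allows, at its root, exactly one of the two moves
-- true and false.  Every implementation commits to one of them, and the single parameter
-- of the deterministic specification parametricChoice can be set to that same move, so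
-- thorough refinement holds.  Modal refinement must fix the parameter before the
-- refining side chooses its move, and choosing the other move then has no match.

open import Defs
open import Data.Nat using (ℕ)
open import Data.Fin using (Fin; zero)
open import Data.Bool using (Bool; true; false; not)
open import Data.Bool.Properties using (not-¬)
open import Data.Unit using (tt)
open import Data.Empty using (⊥; ⊥-elim)
open import Data.Product using (Σ-syntax; _×_; _,_; proj₁; proj₂)
open import Data.Sum using (_⊎_; inj₁; inj₂; [_,_])
open import Data.List using (List; []; _∷_; map)
open import Data.List.Membership.Propositional using (_∈_)
open import Data.List.Relation.Unary.All using (All; []; _∷_; tabulate; lookup)
open import Data.List.Relation.Unary.Any using (here; there)
open import Data.List.Relation.Unary.Any.Properties using (¬Any[])
open import Function using (id)
open import Relation.Nullary using (¬_)
open import Relation.Binary.PropositionalEquality using (_≡_; refl; sym; trans; cong; subst)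

_⊩_ : ∀ {X P : Set} → (X → Set) → Formula (X ⊎ P) → Set
E ⊩ φ = [ E , (λ _ → ⊥) ] ⊨ φ

Matches : ∀ {A X Y : Set} → (X → Y → Set) → (A × X → Set) → (A × Y → Set) → Set
Matches R E F =
  (∀ a s' → E (a , s') → Σ[ t' ∈ _ ] F (a , t') × R s' t') ×
  (∀ a t' → F (a , t') → Σ[ s' ∈ _ ] E (a , s') × R s' t')

Matches-transport : ∀ {A X Y : Set} {R R' : X → Y → Set} {E E' : A × X → Set} {F : A × Y → Set} →
  (∀ {a s t} → F (a , t) → R s t → R' s t) →
  (∀ x → E' x → E x) → (∀ x → E x → E' x) →
  Matches R E F → Matches R' E' F
Matches-transport conv E'⊆E E⊆E' (forth , back) =
  (λ a s e → let t , f , q = forth a s (E'⊆E _ e) in t , f , conv f q) ,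
  (λ a t f → let s , e , q = back a t f in s , E⊆E' _ e , conv f q)

module _ {A X : Set} {np : ℕ} (ν : Fin np → Bool) {E : A × X → Set} where

  ⊩-bigAnd⁺ : ∀ {l} → All E l → E ⊩ instF ν (bigAnd (map inj₁ l))
  ⊩-bigAnd⁺ []       = tt
  ⊩-bigAnd⁺ (e ∷ es) = e , ⊩-bigAnd⁺ es

  ⊩-bigAnd⁻ : ∀ l → E ⊩ instF ν (bigAnd (map inj₁ l)) → All E l
  ⊩-bigAnd⁻ []       tt       = []
  ⊩-bigAnd⁻ (_ ∷ l) (e , es) = e ∷ ⊩-bigAnd⁻ l es

module _ {A : Set} (L : LTS A) (μ : Fin 0 → Bool) where

  impl-tran : ∀ i → Tran (inst (Impl L) μ) i (_∈ Tr L i)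
  impl-tran i = (λ _ m → m) , ⊩-bigAnd⁺ μ {l = Tr L i} (tabulate id)

  impl-tran-⊇ : ∀ {i E} → Tran (inst (Impl L) μ) i E → ∀ x → x ∈ Tr L i → E x
  impl-tran-⊇ {i} (_ , E⊩) _ = lookup (⊩-bigAnd⁻ μ (Tr L i) E⊩)

data Node : Set where
  root leaf : Node

fork : Node → List (Bool × Node)
fork root = (true , leaf) ∷ (false , leaf) ∷ []
fork leaf = []

move∈fork : ∀ b → (b , leaf) ∈ fork root
move∈fork true  = here refl
move∈fork false = there (here refl)

fork-target : ∀ {s a t} → (a , t) ∈ fork s → t ≡ leaf
fork-target {root} (here refl)         = refl
fork-target {root} (there (here refl)) = refl

move : ∀ {n} → Bool → Formula ((Bool × Node) ⊎ Fin n)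
move b = atom (inj₁ (b , leaf))

only : ∀ {n} → Bool → Formula ((Bool × Node) ⊎ Fin n)
only b = move b ∧' (¬' move (not b))

occurs-only : ∀ {n a t} b → Occurs {(Bool × Node) ⊎ Fin n} (inj₁ (a , t)) (only b) → (a , t) ∈ fork root
occurs-only b (inj₁ refl) = move∈fork b
occurs-only b (inj₂ refl) = move∈fork (not b)

exclusiveΦ : Node → Formula ((Bool × Node) ⊎ Fin 0)
exclusiveΦ root = only true ∨' only false
exclusiveΦ leaf = tt

parametricΦ : Node → Formula ((Bool × Node) ⊎ Fin 1)
parametricΦ root = (p ∧' only true) ∨' ((¬' p) ∧' only false)
  where p = atom (inj₂ zero)
parametricΦ leaf = tt

exclusiveChoice : PMTS Bool 0
exclusiveChoice = record { S = Node ; T = fork ; Φ = exclusiveΦ }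

parametricChoice : PMTS Bool 1
parametricChoice = record { S = Node ; T = fork ; Φ = parametricΦ }

exclusiveChoice-wf : WellFormed exclusiveChoice
exclusiveChoice-wf root _ _ (inj₁ o) = occurs-only true o
exclusiveChoice-wf root _ _ (inj₂ o) = occurs-only false o

parametricChoice-wf : WellFormed parametricChoice
parametricChoice-wf root _ _ (inj₁ (inj₂ o)) = occurs-only true o
parametricChoice-wf root _ _ (inj₂ (inj₂ o)) = occurs-only false o

parametricChoice-deterministic : Deterministic parametricChoice
parametricChoice-deterministic _ _ _ _ m m' = trans (fork-target m) (sym (fork-target m'))

exclusive-only : ∀ b {F} → F ⊩ only {0} b → F ⊩ exclusiveΦ root
exclusive-only true  = inj₁
exclusive-only false = inj₂

exclusive-choice : ∀ {F} → F ⊩ exclusiveΦ root → Σ[ b ∈ Bool ] F ⊩ only {0} b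
exclusive-choice (inj₁ o) = true , o
exclusive-choice (inj₂ o) = false , o

parametric-choose : ∀ b {F} → F ⊩ only {0} b → F ⊩ instF (λ _ → b) (parametricΦ root)
parametric-choose true  o = inj₁ (tt , o)
parametric-choose false o = inj₂ ((λ ¬⊤ → ¬⊤ tt) , o)

parametric-only : ∀ ν {F} → F ⊩ instF ν (parametricΦ root) → F ⊩ only {0} (ν zero)
parametric-only ν sat with ν zero | sat
... | true  | inj₁ (_ , o)  = o
... | true  | inj₂ (¬⊤ , _) = ⊥-elim (¬⊤ tt)
... | false | inj₁ (¬⊤ , _) = ⊥-elim (¬⊤ tt)
... | false | inj₂ (_ , o)  = o

single-move-tran : ∀ μ b → Tran (inst exclusiveChoice μ) root (_≡ (b , leaf))
single-move-tran μ b =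
  (λ { _ refl → move∈fork b }) ,
  exclusive-only b {_≡ (b , leaf)} (refl , λ eq → not-¬ refl (sym (cong proj₁ eq)))

exclusive≰mparametric : ¬ (exclusiveChoice ⊢ root ≤m parametricChoice ⊢ root)
exclusive≰mparametric ≤m =
  let ν , R , R-refines , r = ≤m (λ ())
      b = not (ν zero)
      F , (F⊆ , F⊩) , (forth , _) = R-refines root root r (_≡ (b , leaf)) (single-move-tran (λ ()) b)
      _ , f , _ = forth b leaf refl
  in proj₂ (parametric-only ν {F} F⊩) (subst (λ t → F (b , t)) (fork-target (F⊆ _ f)) f)

-- root is the target of no transition, so it suffices to relate it to i alone; other
-- states R relates to root may have committed to the other move.
Rooted : ∀ {X : Set} → (X → Node → Set) → X → X → Node → Set
Rooted R i x root = x ≡ i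
Rooted R i x leaf = R x leaf

at-leaf : ∀ {X : Set} {R : X → Node → Set} {i s t} → t ≡ leaf → R s t → Rooted R i s t
at-leaf refl q = q

rooted-refinement : ∀ {L : LTS Bool} {μ μ' ν R} →
  IsModalRefinement (inst (Impl L) μ) (inst exclusiveChoice μ') R →
  ∀ i F → Tran (inst parametricChoice ν) root F → Matches R (_∈ Tr L i) F →
  IsModalRefinement (inst (Impl L) μ) (inst parametricChoice ν) (Rooted R i)
rooted-refinement {L} {μ} _ i F F-tran@(F⊆ , _) F-matches .i root refl E E-tran@(E⊆ , _) =
  F , F-tran ,
  Matches-transport (λ f → at-leaf (fork-target (F⊆ _ f))) E⊆ (impl-tran-⊇ L μ E-tran) F-matches
rooted-refinement R-refines _ _ _ _ x leaf q E E-tran =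
  let F , F-tran@(F⊆ , _) , F-matches = R-refines x leaf q E E-tran
  in F , F-tran , Matches-transport (λ f → ⊥-elim (¬Any[] (F⊆ _ f))) (λ _ e → e) (λ _ e → e) F-matches

exclusive≤tparametric : exclusiveChoice ⊢ root ≤t parametricChoice ⊢ root
exclusive≤tparametric L i i≤ μ =
  let _ , R , R-refines , r = i≤ μ
      F , (F⊆ , F⊩) , F-matches = R-refines i root r (_∈ Tr L i) (impl-tran L μ i)
      b , F⊩only = exclusive-choice {F} F⊩
  in (λ _ → b) , Rooted R i ,
     rooted-refinement R-refines i F (F⊆ , parametric-choose b {F} F⊩only) F-matches , refl

corollary1 : Σ[ A ∈ Set ] Σ[ n₁ ∈ ℕ ] Σ[ M ∈ PMTS A n₁ ] Σ[ n₂ ∈ ℕ ] Σ[ N ∈ PMTS A n₂ ]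
    WellFormed M × WellFormed N × Deterministic N ×
    (Σ[ s₀ ∈ S M ] Σ[ t₀ ∈ S N ] (M ⊢ s₀ ≤t N ⊢ t₀) × ¬ (M ⊢ s₀ ≤m N ⊢ t₀))
corollary1 =
  Bool , 0 , exclusiveChoice , 1 , parametricChoice ,
  exclusiveChoice-wf , parametricChoice-wf , parametricChoice-deterministic ,
  root , root , exclusive≤tparametric , exclusive≰mparametric
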